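{- For a positive integer $n\ge 2$ let $P_n=\prod_{i=1}^n(i^2+1)$ and $L_n=\operatorname{lcm}(1^2+1,\dots,n^2+1)$, and for a prime $p$ let $\alpha_p(n)$, $\beta_p(n)$ be the exponents of $p$ in $P_n$ and $L_n$ respectively. Then for primes $p\equiv 1\pmod 4$: (i) $\beta_p(n)\ll \dfrac{\log n}{\log p}$; (ii) $\alpha_p(n)=\dfrac{2n}{p-1}+O\!\left(\dfrac{\log n}{\log p}\right)$, with implied constants absolute (independent of $p$ and $n$).
   Context: The exponent of a prime $p$ in a positive integer $m$ is the largest $k\ge0$ with $p^k\mid m$. -}

module Defs where

open import Data.Nat using (ℕ; zero; suc; _+_; _*_; _^_)
open import Data.Nat.Divisibility using (_∣_)
open import Data.Nat.LCM using (lcm)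
open import Data.Product using (_×_)
open import Relation.Nullary using (¬_)

P : ℕ → ℕ
P zero    = 1
P (suc n) = P n * (suc n ^ 2 + 1)

L : ℕ → ℕ
L zero    = 1
L (suc n) = lcm (L n) (suc n ^ 2 + 1)

IsExponent : ℕ → ℕ → ℕ → Set
IsExponent p m k = (p ^ k ∣ m) × ¬ (p ^ suc k ∣ m)

module Submission where

-- (i) A prime power dividing an lcm divides one of its arguments, so p^β ≤ n² + 1.
-- (ii) Counting pairs (i, j) with pʲ ∣ i² + 1 gives α = Σⱼ Nⱼ, Nⱼ = #{i ≤ n : pʲ ∣ i² + 1}.
-- −1 is a square mod p (parity of the fixed points of the involution x ↦ ±x⁻¹ on
-- {1, …, 2k}, p = 4k + 1), hence mod every pʲ (Hensel); as p is odd there are exactly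
-- two roots per period pʲ, so  2⌊n/pʲ⌋ ≤ Nⱼ ≤ 2⌊n/pʲ⌋ + 2·[pʲ ≤ n² + 1].  With
-- q·Σⱼ ⌊n/pʲ⌋ ≤ n ≤ q·Σ_{j≤J} ⌊n/pʲ⌋ + q·J + ⌊n/pᴶ⌋ this yields  qα ≤ 2n + 2q·K
-- (pᴷ ≤ n² + 1)  and  2n ≤ qα + 2q·(J + 1)  (pᴶ ≤ n < pᴶ⁺¹); when p > n the growth
-- bound mⁿ ≤ n²ᵐ (2 ≤ n ≤ m) replaces the latter.

open import Defs
open import Data.Nat
open import Data.Nat.Properties
open import Data.Nat.Divisibility
open import Data.Nat.DivMod
open import Data.Nat.GCD using (gcd[m,n]∣m; gcd[m,n]∣n; module Bézout)
open import Data.Nat.LCM using (lcm; lcm-least; lcm-comm)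
open import Data.Nat.Coprimality using (gcd≡1⇒coprime; coprime-Bézout)
open import Data.Nat.Primality
open import Data.Nat.Tactic.RingSolver using (solve-∀)
open import Data.Product
open import Data.Sum
open import Data.Empty
open import Relation.Nullary using (¬_; Dec; yes; no)
open import Relation.Nullary.Decidable using (_⊎-dec_)
open import Relation.Binary.PropositionalEquality

sumTo : (ℕ → ℕ) → ℕ → ℕ
sumTo f zero    = 0
sumTo f (suc n) = sumTo f n + f (suc n)

𝟙 : ∀ {a} {A : Set a} → Dec A → ℕ
𝟙 (yes _) = 1
𝟙 (no _)  = 0

𝟙-yes : ∀ {a} {A : Set a} (d : Dec A) → A → 𝟙 d ≡ 1
𝟙-yes (yes _) _ = refl
𝟙-yes (no ¬a) a = ⊥-elim (¬a a)

𝟙-no : ∀ {a} {A : Set a} (d : Dec A) → ¬ A → 𝟙 d ≡ 0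
𝟙-no (yes a) ¬a = ⊥-elim (¬a a)
𝟙-no (no _)  _  = refl

𝟙-iff : ∀ {a b} {A : Set a} {B : Set b} (da : Dec A) (db : Dec B) →
        (A → B) → (B → A) → 𝟙 da ≡ 𝟙 db
𝟙-iff (yes a) (yes b) f g = refl
𝟙-iff (yes a) (no ¬b) f g = ⊥-elim (¬b (f a))
𝟙-iff (no ¬a) (yes b) f g = ⊥-elim (¬a (g b))
𝟙-iff (no ¬a) (no ¬b) f g = refl

sum-cong : ∀ {f g} n → (∀ i → 0 < i → i ≤ n → f i ≡ g i) → sumTo f n ≡ sumTo g n
sum-cong zero    h = refl
sum-cong (suc n) h =
  cong₂ _+_ (sum-cong n λ i i>0 i≤n → h i i>0 (m≤n⇒m≤1+n i≤n)) (h (suc n) z<s ≤-refl)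

sum-zero : ∀ f n → (∀ i → 0 < i → i ≤ n → f i ≡ 0) → sumTo f n ≡ 0
sum-zero f n h = trans (sum-cong n h) (zeros n)
  where
  zeros : ∀ n → sumTo (λ _ → 0) n ≡ 0
  zeros zero    = refl
  zeros (suc n) = cong (_+ 0) (zeros n)

sum-mono : ∀ {f g} n → (∀ i → 0 < i → i ≤ n → f i ≤ g i) → sumTo f n ≤ sumTo g n
sum-mono zero    h = z≤n
sum-mono (suc n) h =
  +-mono-≤ (sum-mono n λ i i>0 i≤n → h i i>0 (m≤n⇒m≤1+n i≤n)) (h (suc n) z<s ≤-refl)

sum-mono-range : ∀ f {m n} → m ≤ n → sumTo f m ≤ sumTo f n
sum-mono-range f {n = zero}  z≤n = ≤-refl
sum-mono-range f {n = suc n} m≤1+n with m≤n⇒m<n∨m≡n m≤1+n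
... | inj₁ (s≤s m≤n) = ≤-trans (sum-mono-range f m≤n) (m≤m+n _ _)
... | inj₂ refl      = ≤-refl

sum-+ : ∀ f g n → sumTo (λ i → f i + g i) n ≡ sumTo f n + sumTo g n
sum-+ f g zero    = refl
sum-+ f g (suc n) rewrite sum-+ f g n = interchange (sumTo f n) (sumTo g n) (f (suc n)) (g (suc n))
  where
  interchange : ∀ a b c d → a + b + (c + d) ≡ a + c + (b + d)
  interchange = solve-∀

sum-* : ∀ c f n → sumTo (λ i → c * f i) n ≡ c * sumTo f n
sum-* c f zero    = sym (*-zeroʳ c)
sum-* c f (suc n) rewrite sum-* c f n = sym (*-distribˡ-+ c (sumTo f n) (f (suc n)))

sum-swap : ∀ (h : ℕ → ℕ → ℕ) n J →
           sumTo (λ i → sumTo (h i) J) n ≡ sumTo (λ j → sumTo (λ i → h i j) n) J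
sum-swap h zero    J = sym (sum-zero _ J λ _ _ _ → refl)
sum-swap h (suc n) J rewrite sum-swap h n J =
  sym (sum-+ (λ j → sumTo (λ i → h i j) n) (h (suc n)) J)

sum-shift : ∀ f n → sumTo f (suc n) ≡ f 1 + sumTo (λ i → f (suc i)) n
sum-shift f zero    = +-comm 0 (f 1)
sum-shift f (suc n) rewrite sum-shift f n = +-assoc (f 1) _ _

sum-periodic : ∀ f Q → (∀ i → f (i + Q) ≡ f i) →
               ∀ b a → sumTo f (b + a * Q) ≡ sumTo f b + a * sumTo f Q
sum-periodic f Q per b zero rewrite +-identityʳ b = sym (+-identityʳ _)
sum-periodic f Q per b (suc a) = begin
  sumTo f (b + (Q + a * Q))        ≡⟨ cong (sumTo f) (reassoc b Q (a * Q)) ⟩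
  sumTo f ((b + a * Q) + Q)        ≡⟨ one-period (b + a * Q) ⟩
  sumTo f (b + a * Q) + sumTo f Q  ≡⟨ cong (_+ sumTo f Q) (sum-periodic f Q per b a) ⟩
  sumTo f b + a * T + T            ≡⟨ +-assoc (sumTo f b) (a * T) T ⟩
  sumTo f b + (a * T + T)          ≡⟨ cong (sumTo f b +_) (+-comm (a * T) T) ⟩
  sumTo f b + (T + a * T)          ∎
  where
  open ≡-Reasoning
  T : ℕ
  T = sumTo f Q
  reassoc : ∀ b q c → b + (q + c) ≡ (b + c) + q
  reassoc = solve-∀
  one-period : ∀ m → sumTo f (m + Q) ≡ sumTo f m + T
  one-period zero = refl
  one-period (suc m) rewrite one-period m | per (suc m) = swap-last (sumTo f m) T (f (suc m))
    where
    swap-last : ∀ a b c → a + b + c ≡ a + c + b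
    swap-last = solve-∀

sum-point : ∀ a n → 0 < a → a ≤ n → sumTo (λ i → 𝟙 (i ≟ a)) n ≡ 1
sum-point a zero () z≤n
sum-point a (suc n) a>0 a≤1+n with m≤n⇒m<n∨m≡n a≤1+n
... | inj₁ (s≤s a≤n) rewrite sum-point a n a>0 a≤n
                           | 𝟙-no (suc n ≟ a) (λ e → <⇒≢ (s≤s a≤n) (sym e)) = refl
... | inj₂ refl rewrite 𝟙-yes (suc n ≟ suc n) refl = cong (_+ 1) (sum-zero _ n below)
  where
  below : ∀ i → 0 < i → i ≤ n → 𝟙 (i ≟ suc n) ≡ 0
  below i _ i≤n = 𝟙-no (i ≟ suc n) (λ e → <⇒≢ (s≤s i≤n) e)

count≥2⇒witness : ∀ {P : ℕ → Set} (P? : ∀ i → Dec (P i)) n →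
                  2 ≤ sumTo (λ i → 𝟙 (P? i)) n → ∃[ x ] (2 ≤ x × x ≤ n × P x)
count≥2⇒witness P? (suc n) two with P? (suc n)
count≥2⇒witness P? (suc zero)    two | yes _ = ⊥-elim (<-irrefl refl two)
count≥2⇒witness P? (suc (suc n)) two | yes Pn = suc (suc n) , s≤s (s≤s z≤n) , ≤-refl , Pn
... | no _ with count≥2⇒witness P? n (subst (2 ≤_) (+-identityʳ _) two)
... | x , x≥2 , x≤n , Px = x , x≥2 , m≤n⇒m≤1+n x≤n , Px

-- Fixed points of an involution have the parity of the set it acts on

record Involution (N : ℕ) (f : ℕ → ℕ) : Set where
  field
    maps-into  : ∀ x → 0 < x → x ≤ N → 0 < f x × f x ≤ N
    involutive : ∀ x → 0 < x → x ≤ N → f (f x) ≡ x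

fixedCount : (ℕ → ℕ) → ℕ → ℕ
fixedCount f N = sumTo (λ i → 𝟙 (f i ≟ i)) N

module _ {M : ℕ} {f : ℕ → ℕ} (inv : Involution (suc M) f) where
  open Involution inv

  sent-to-top : ∀ x → 0 < x → x ≤ M → f x ≡ suc M → x ≡ f (suc M)
  sent-to-top x x>0 x≤M fx≡N = trans (sym (involutive x x>0 (m≤n⇒m≤1+n x≤M))) (cong f fx≡N)

  stays-below : ∀ x → 0 < x → x ≤ M → x ≢ f (suc M) → 0 < f x × f x ≤ M
  stays-below x x>0 x≤M x≢y with maps-into x x>0 (m≤n⇒m≤1+n x≤M)
  ... | fx>0 , fx≤N with m≤n⇒m<n∨m≡n fx≤N
  ... | inj₁ (s≤s fx≤M) = fx>0 , fx≤M
  ... | inj₂ fx≡N       = ⊥-elim (x≢y (sent-to-top x x>0 x≤M fx≡N))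

  restrict : f (suc M) ≡ suc M → Involution M f
  restrict top-fixed = record
    { maps-into  = λ x x>0 x≤M → stays-below x x>0 x≤M (top≢ x x≤M)
    ; involutive = λ x x>0 x≤M → involutive x x>0 (m≤n⇒m≤1+n x≤M) }
    where
    top≢ : ∀ x → x ≤ M → x ≢ f (suc M)
    top≢ x x≤M x≡ = <⇒≢ (s≤s x≤M) (trans x≡ top-fixed)

-- detach f N: f with the 2-cycle through N cut, its other point made fixed.
detach : (ℕ → ℕ) → ℕ → ℕ → ℕ
detach f N x with f x ≟ N
... | yes _ = x
... | no _  = f x

detach-spec : ∀ f N x → (f x ≡ N × detach f N x ≡ x) ⊎ (f x ≢ N × detach f N x ≡ f x)
detach-spec f N x with f x ≟ N
... | yes e  = inj₁ (e , refl)
... | no ¬e = inj₂ (¬e , refl)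

module _ {M : ℕ} {f : ℕ → ℕ} (inv : Involution (suc M) f) (top-moved : f (suc M) ≢ suc M) where
  open Involution inv

  private
    y : ℕ
    y = f (suc M)
    g : ℕ → ℕ
    g = detach f (suc M)

  top-partner-range : 0 < y × y ≤ M
  top-partner-range with maps-into (suc M) z<s ≤-refl
  ... | y>0 , y≤N with m≤n⇒m<n∨m≡n y≤N
  ... | inj₁ (s≤s y≤M) = y>0 , y≤M
  ... | inj₂ y≡N       = ⊥-elim (top-moved y≡N)

  detach-involution : Involution M g
  detach-involution = record { maps-into = into ; involutive = back }
    where
    into : ∀ x → 0 < x → x ≤ M → 0 < g x × g x ≤ M
    into x x>0 x≤M with detach-spec f (suc M) x
    ... | inj₁ (_ , gx≡x)   = subst (0 <_) (sym gx≡x) x>0 , subst (_≤ M) (sym gx≡x) x≤M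
    ... | inj₂ (fx≢N , gx≡fx) rewrite gx≡fx =
      stays-below inv x x>0 x≤M (λ x≡y → fx≢N (trans (cong f x≡y) (involutive (suc M) z<s ≤-refl)))
    back : ∀ x → 0 < x → x ≤ M → g (g x) ≡ x
    back x x>0 x≤M with detach-spec f (suc M) x
    ... | inj₁ (_ , gx≡x) = trans (cong g gx≡x) gx≡x
    ... | inj₂ (_ , gx≡fx) with detach-spec f (suc M) (f x)
    ...   | inj₁ (ffx≡N , _)  = ⊥-elim (<⇒≢ (s≤s x≤M) (trans (sym (involutive x x>0 (m≤n⇒m≤1+n x≤M))) ffx≡N))
    ...   | inj₂ (_ , gfx≡ffx) = trans (cong g gx≡fx) (trans gfx≡ffx (involutive x x>0 (m≤n⇒m≤1+n x≤M)))

  -- Cutting the cycle adds exactly one fixed point, namely y.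
  detach-fixedCount : fixedCount g M ≡ fixedCount f M + 1
  detach-fixedCount = begin
    fixedCount g M                                         ≡⟨ sum-cong M pointwise ⟩
    sumTo (λ i → 𝟙 (f i ≟ i) + 𝟙 (i ≟ y)) M                ≡⟨ sum-+ (λ i → 𝟙 (f i ≟ i)) (λ i → 𝟙 (i ≟ y)) M ⟩
    fixedCount f M + sumTo (λ i → 𝟙 (i ≟ y)) M             ≡⟨ cong (fixedCount f M +_) (sum-point y M (proj₁ top-partner-range) (proj₂ top-partner-range)) ⟩
    fixedCount f M + 1                                     ∎
    where
    open ≡-Reasoning
    pointwise : ∀ i → 0 < i → i ≤ M → 𝟙 (g i ≟ i) ≡ 𝟙 (f i ≟ i) + 𝟙 (i ≟ y)
    pointwise i i>0 i≤M with i ≟ y | detach-spec f (suc M) i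
    ... | yes i≡y | inj₁ (fi≡N , gi≡i) rewrite gi≡i
      | 𝟙-yes (i ≟ i) refl | 𝟙-no (f i ≟ i) (λ fi≡i → <⇒≢ (s≤s i≤M) (trans (sym fi≡i) fi≡N)) = refl
    ... | yes i≡y | inj₂ (fi≢N , _) = ⊥-elim (fi≢N (trans (cong f i≡y) (involutive (suc M) z<s ≤-refl)))
    ... | no i≢y  | inj₁ (fi≡N , _) = ⊥-elim (i≢y (sent-to-top inv i i>0 i≤M fi≡N))
    ... | no i≢y  | inj₂ (_ , gi≡fi) rewrite gi≡fi = sym (+-identityʳ _)

involution-parity : ∀ N (f : ℕ → ℕ) → Involution N f → ∃[ t ] (fixedCount f N + N ≡ 2 * t)
involution-parity zero    f _ = 0 , refl
involution-parity (suc M) f inv with f (suc M) ≟ suc M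
... | yes top-fixed =
  let (t , eq) = involution-parity M f (restrict inv top-fixed) in
  suc t , (begin
    fixedCount f M + 1 + suc M  ≡⟨ regroup (fixedCount f M) M ⟩
    (fixedCount f M + M) + 2    ≡⟨ cong (_+ 2) eq ⟩
    2 * t + 2                   ≡⟨ +-comm (2 * t) 2 ⟩
    2 + 2 * t                   ≡⟨ *-suc 2 t ⟨
    2 * suc t                   ∎)
  where
  open ≡-Reasoning
  regroup : ∀ a m → a + 1 + suc m ≡ (a + m) + 2
  regroup = solve-∀
... | no top-moved =
  let (t , eq) = involution-parity M _ (detach-involution inv top-moved) in
  t , (begin
    fixedCount f M + 0 + suc M  ≡⟨ regroup (fixedCount f M) M ⟩
    (fixedCount f M + 1) + M    ≡⟨ cong (_+ M) (detach-fixedCount inv top-moved) ⟨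
    fixedCount (detach f (suc M)) M + M   ≡⟨ eq ⟩
    2 * t                       ∎)
  where
  open ≡-Reasoning
  regroup : ∀ a m → a + 0 + suc m ≡ (a + 1) + m
  regroup = solve-∀

prime>1 : ∀ {p} → Prime p → 1 < p
prime>1 {p} pp = nonTrivial⇒n>1 p {{prime⇒nonTrivial pp}}

multiple-below : ∀ {d n} → d ∣ n → n < d → n ≡ 0
multiple-below {n = zero}  _   _   = refl
multiple-below {n = suc n} d∣n n<d = ⊥-elim (<⇒≱ n<d (∣⇒≤ d∣n))

multiple-below-double : ∀ {d n} → d ∣ n → 0 < n → n < 2 * d → n ≡ d
multiple-below-double (divides zero refl)          () _
multiple-below-double (divides (suc zero) refl)    _  _ = +-identityʳ _
multiple-below-double {d} (divides (suc (suc q)) refl) _ n<2d =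
  ⊥-elim (<⇒≱ n<2d (+-monoʳ-≤ d (≤-trans (≤-reflexive (+-identityʳ d)) (m≤m+n d (q * d)))))

prime≡1mod4⇒∤2 : ∀ {p} → Prime p → p % 4 ≡ 1 → ¬ p ∣ 2
prime≡1mod4⇒∤2 pp p%4≡1 p∣2 with ≤-antisym (∣⇒≤ p∣2) (prime>1 pp)
prime≡1mod4⇒∤2 pp () p∣2 | refl

linear-congruence : ∀ {p c} → Prime p → ¬ p ∣ c → ∀ s → ∃[ t ] (p ∣ s + c * t)
linear-congruence {p} {c} pp p∤c s with prime⇒irreducible pp (gcd[m,n]∣n c p)
... | inj₂ g≡p = ⊥-elim (p∤c (subst (_∣ c) g≡p (gcd[m,n]∣m c p)))
... | inj₁ g≡1 with coprime-Bézout (gcd≡1⇒coprime {c} {p} g≡1)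
... | Bézout.Identity.-+ x y 1+xc≡yp = s * x , divides (s * y) (begin
      s + c * (s * x)  ≡⟨ factor s c x ⟩
      s * (1 + x * c)  ≡⟨ cong (s *_) 1+xc≡yp ⟩
      s * (y * p)      ≡⟨ *-assoc s y p ⟨
      s * y * p        ∎)
  where
  open ≡-Reasoning
  factor : ∀ s c x → s + c * (s * x) ≡ s * (1 + x * c)
  factor = solve-∀
... | Bézout.Identity.+- x y 1+yp≡xc = s * q * x , divides (s + s * q * y) (begin
      s + c * (s * q * x)           ≡⟨ reassoc s c q x ⟩
      s + s * q * (x * c)           ≡⟨ cong (λ z → s + s * q * z) (sym 1+yp≡xc) ⟩
      s + s * q * (1 + y * p)       ≡⟨ cong (λ z → s + s * q * (1 + y * z)) (sym 1+q≡p) ⟩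
      s + s * q * (1 + y * suc q)   ≡⟨ factor s q y ⟩
      (s + s * q * y) * suc q       ≡⟨ cong ((s + s * q * y) *_) 1+q≡p ⟩
      (s + s * q * y) * p           ∎)
  where
  open ≡-Reasoning
  -- x·c ≡ 1 (mod p), so t = s·(p−1)·x gives s + c·t ≡ s·p ≡ 0.
  q : ℕ
  q = p ∸ 1
  1+q≡p : suc q ≡ p
  1+q≡p = trans (+-comm 1 q) (m∸n+n≡m (<⇒≤ (prime>1 pp)))
  reassoc : ∀ s c q x → s + c * (s * q * x) ≡ s + s * q * (x * c)
  reassoc = solve-∀
  factor : ∀ s q y → s + s * q * (1 + y * suc q) ≡ (s + s * q * y) * suc q
  factor = solve-∀

prime-power-cancel : ∀ {p b} → Prime p → ¬ p ∣ b → ∀ k a → p ^ k ∣ a * b → p ^ k ∣ a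
prime-power-cancel pp p∤b zero    a _ = 1∣ a
prime-power-cancel {p} {b} pp p∤b (suc k) a pᵏ⁺¹∣ab
  with euclidsLemma a b pp (∣-trans (m∣m*n (p ^ k)) pᵏ⁺¹∣ab)
... | inj₂ p∣b = ⊥-elim (p∤b p∣b)
... | inj₁ (divides a' refl) = subst (p * p ^ k ∣_) (*-comm p a') (*-monoʳ-∣ p pᵏ∣a')
  where
  instance _ = prime⇒nonZero pp
  pᵏ∣a' : p ^ k ∣ a'
  pᵏ∣a' = prime-power-cancel pp p∤b k a' (*-cancelˡ-∣ p
            (subst (p * p ^ k ∣_) (trans (cong (_* b) (*-comm a' p)) (*-assoc p a' b)) pᵏ⁺¹∣ab))

pow∣pow : ∀ p {a b} → a ≤ b → p ^ a ∣ p ^ b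
pow∣pow p {a} {b} a≤b =
  divides (p ^ (b ∸ a)) (trans (cong (p ^_) (sym (m∸n+n≡m a≤b))) (^-distribˡ-+-* p (b ∸ a) a))

lower-power-divides : ∀ p {m i j c} → m ≡ p ^ j * c → i ≤ j → p ^ i ∣ m
lower-power-divides p m≡pʲc i≤j = subst (_ ∣_) (sym m≡pʲc) (∣-trans (pow∣pow p i≤j) (∣m⇒∣m*n _ ∣-refl))

root-coprime : ∀ {p r} → 1 < p → p ∣ r * r + 1 → ¬ p ∣ r
root-coprime {r = r} p>1 p∣r²+1 p∣r = <⇒≢ p>1 (sym (∣1⇒≡1 (∣m+n∣m⇒∣n p∣r²+1 (∣m⇒∣m*n r p∣r))))

n<m^n : ∀ m → 1 < m → ∀ n → n < m ^ n
n<m^n m m>1 zero    = s≤s z≤n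
n<m^n m m>1 (suc n) = begin-strict
  suc n        ≤⟨ n<m^n m m>1 n ⟩
  m ^ n        <⟨ m<m+n (m ^ n) (m^n>0 m n) ⟩
  m ^ n + m ^ n ≡⟨ cong (m ^ n +_) (+-identityʳ (m ^ n)) ⟨
  2 * m ^ n    ≤⟨ *-monoˡ-≤ (m ^ n) m>1 ⟩
  m * m ^ n    ∎
  where
  open ≤-Reasoning
  instance _ = >-nonZero (<-trans z<s m>1)

small-not-divisible : ∀ {p x} → 0 < x → x < p → ¬ p ∣ x
small-not-divisible x>0 x<p p∣x = <⇒≱ x<p (∣⇒≤ {{>-nonZero x>0}} p∣x)

congruence-mod : ∀ {p} .{{_ : NonZero p}} a x t → p ∣ a + x * t → p ∣ a + x * (t % p)
congruence-mod {p} a x t p∣ = ∣m+n∣m⇒∣n (subst (p ∣_) split p∣) (n∣m*n (x * (t / p)))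
  where
  split : a + x * t ≡ (x * (t / p)) * p + (a + x * (t % p))
  split = trans (cong (λ w → a + x * w) (m≡m%n+[m/n]*n t p)) (regroup a x (t % p) (t / p) p)
    where
    regroup : ∀ a x r d p → a + x * (r + d * p) ≡ (x * d) * p + (a + x * r)
    regroup = solve-∀

-- −1 is a square modulo a prime p ≡ 1 (mod 4)
--
-- Write p = 4k + 1 and H = 2k.  For x ∈ {1, …, H} there is exactly one
-- y ∈ {1, …, H} with x·y ≡ ±1 (mod p), and x ↦ y is an involution of {1, …, H}.
-- Its fixed points satisfy x² ≡ ±1, and x² ≡ 1 only for x = 1.  Since H is even,
-- the involution has an even number of fixed points, hence one with x² ≡ −1.

-- The largest i ∈ {1, …, n} satisfying a decidable predicate (0 if none does).
search : {P : ℕ → Set} → (∀ i → Dec (P i)) → ℕ → ℕ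
search P? zero    = 0
search P? (suc n) with P? (suc n)
... | yes _ = suc n
... | no _  = search P? n

search-spec : ∀ {P : ℕ → Set} (P? : ∀ i → Dec (P i)) n → ∃[ y ] (0 < y × y ≤ n × P y) →
              0 < search P? n × search P? n ≤ n × P (search P? n)
search-spec P? zero    (y , y>0 , y≤0 , _) = ⊥-elim (<-irrefl refl (≤-trans y>0 y≤0))
search-spec P? (suc n) (y , y>0 , y≤1+n , Py) with P? (suc n)
... | yes P1+n = z<s , ≤-refl , P1+n
... | no ¬P1+n with m≤n⇒m<n∨m≡n y≤1+n
...   | inj₂ refl      = ⊥-elim (¬P1+n Py)
...   | inj₁ (s≤s y≤n) with search-spec P? n (y , y>0 , y≤n , Py)
...     | s>0 , s≤n , Ps = s>0 , m≤n⇒m≤1+n s≤n , Ps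

module SquareRootOfMinusOne (p k : ℕ) (pp : Prime p) (p≡4k+1 : p ≡ suc (4 * k)) where

  instance _ = prime⇒nonZero pp

  H : ℕ
  H = 2 * k

  double-H : H + H ≡ 4 * k
  double-H = doubling k
    where
    doubling : ∀ k → 2 * k + 2 * k ≡ 4 * k
    doubling = solve-∀

  H<p : H < p
  H<p = subst (H <_) (sym p≡4k+1) (s≤s (≤-trans (m≤m+n H H) (≤-reflexive double-H)))

  Half : ℕ → Set
  Half x = 0 < x × x ≤ H

  half-not-divisible : ∀ {x} → Half x → ¬ p ∣ x
  half-not-divisible (x>0 , x≤H) = small-not-divisible x>0 (≤-<-trans x≤H H<p)

  -- x·y ≡ ±1 (mod p);  note 4k ≡ −1.
  Partners : ℕ → ℕ → Set
  Partners x y = p ∣ x * y + 1 ⊎ p ∣ x * y + 4 * k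

  partners? : ∀ x y → Dec (Partners x y)
  partners? x y = (p ∣? x * y + 1) ⊎-dec (p ∣? x * y + 4 * k)

  partners-sym : ∀ {x y} → Partners x y → Partners y x
  partners-sym {x} {y} = Data.Sum.map (subst (λ v → p ∣ v + 1) (*-comm x y))
                                      (subst (λ v → p ∣ v + 4 * k) (*-comm x y))

  -- Solve x·t ≡ −1, reduce t mod p to z, and reflect z into the half system.
  partner-exists : ∀ x → Half x → ∃[ y ] (0 < y × y ≤ H × Partners x y)
  partner-exists x half-x with linear-congruence pp (half-not-divisible half-x) 1
  ... | t , p∣1+xt = reflect (H <? z)
    where
    z : ℕ
    z = t % p
    p∣1+xz : p ∣ 1 + x * z
    p∣1+xz = congruence-mod 1 x t p∣1+xt
    z>0 : 0 < z
    z>0 = n≢0⇒n>0 λ z≡0 → <⇒≢ (prime>1 pp)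
            (sym (∣1⇒≡1 (subst (λ v → p ∣ 1 + v) (trans (cong (x *_) z≡0) (*-zeroʳ x)) p∣1+xz)))
    reflect : Dec (H < z) → ∃[ y ] (0 < y × y ≤ H × Partners x y)
    reflect (no z≯H) = z , z>0 , ≮⇒≥ z≯H , inj₁ (subst (p ∣_) (+-comm 1 (x * z)) p∣1+xz)
    reflect (yes H<z) = p ∸ z , m<n⇒0<n∸m z<p , ≤-trans (∸-monoʳ-≤ p H<z) p∸H+1≤H , inj₂ p∣x[p-z]+4k
      where
      z<p : z < p
      z<p = m%n<n t p
      p∸H+1≤H : p ∸ suc H ≤ H
      p∸H+1≤H = ≤-reflexive (trans (cong (_∸ suc H) p≡4k+1) (trans (cong (_∸ H) (sym double-H)) (m+n∸m≡n H H)))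
      -- (1 + x·z) + (x·(p − z) + 4k) = (x + 1)·p
      p∣x[p-z]+4k : p ∣ x * (p ∸ z) + 4 * k
      p∣x[p-z]+4k = ∣m+n∣m⇒∣n {m = 1 + x * z} (subst (p ∣_) (sym total) (n∣m*n (suc x))) p∣1+xz
        where
        w : ℕ
        w = p ∸ z
        total : 1 + x * z + (x * w + 4 * k) ≡ suc x * p
        total = begin
          1 + x * z + (x * w + 4 * k)  ≡⟨ regroup x z w k ⟩
          x * (z + w) + suc (4 * k)    ≡⟨ cong₂ (λ a b → x * a + b) (m+[n∸m]≡n (<⇒≤ z<p)) (sym p≡4k+1) ⟩
          x * p + p                    ≡⟨ +-comm (x * p) p ⟩
          suc x * p                    ∎
          where
          open ≡-Reasoning
          regroup : ∀ x z w k → 1 + x * z + (x * w + 4 * k) ≡ x * (z + w) + suc (4 * k)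
          regroup = solve-∀

  -- Two partners of the same sign coincide: p ∣ x·(y′ − y) with 0 ≤ y′ − y < p.
  same-sign-unique : ∀ {x y y′} c → Half x → y′ ≤ H → y ≤ y′ →
                     p ∣ x * y + c → p ∣ x * y′ + c → y ≡ y′
  same-sign-unique {x} {y} {y′} c half-x y′≤H y≤y′ p∣xy+c p∣xy′+c =
    trans (sym (+-identityʳ y)) (trans (cong (y +_) (sym w≡0)) (m+[n∸m]≡n y≤y′))
    where
    w : ℕ
    w = y′ ∸ y
    split : x * y′ + c ≡ (x * y + c) + x * w
    split = trans (cong (λ v → x * v + c) (sym (m+[n∸m]≡n y≤y′))) (regroup x y w c)
      where
      regroup : ∀ x y w c → x * (y + w) + c ≡ (x * y + c) + x * w
      regroup = solve-∀
    w≡0 : w ≡ 0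
    w≡0 with euclidsLemma x w pp (∣m+n∣m⇒∣n (subst (p ∣_) split p∣xy′+c) p∣xy+c)
    ... | inj₁ p∣x = ⊥-elim (half-not-divisible half-x p∣x)
    ... | inj₂ p∣w = multiple-below p∣w (≤-<-trans (≤-trans (m∸n≤m y′ y) y′≤H) H<p)

  -- Partners of opposite signs would give p ∣ x·(y + y′) with 0 < y + y′ < p.
  opposite-signs-impossible : ∀ {x y y′} → Half x → Half y → Half y′ →
                              p ∣ x * y + 1 → p ∣ x * y′ + 4 * k → ⊥
  opposite-signs-impossible {x} {y} {y′} half-x (y>0 , y≤H) (_ , y′≤H) p∣xy+1 p∣xy′+4k
    with euclidsLemma x (y + y′) pp p∣x[y+y′]
    where
    total : (x * y + 1) + (x * y′ + 4 * k) ≡ p + x * (y + y′)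
    total = trans (regroup x y y′ k) (cong (_+ x * (y + y′)) (sym p≡4k+1))
      where
      regroup : ∀ x y y′ k → (x * y + 1) + (x * y′ + 4 * k) ≡ suc (4 * k) + x * (y + y′)
      regroup = solve-∀
    p∣x[y+y′] : p ∣ x * (y + y′)
    p∣x[y+y′] = ∣m+n∣m⇒∣n (subst (p ∣_) total (∣m∣n⇒∣m+n p∣xy+1 p∣xy′+4k)) ∣-refl
  ... | inj₁ p∣x     = half-not-divisible half-x p∣x
  ... | inj₂ p∣y+y′ = small-not-divisible (≤-trans y>0 (m≤m+n y y′)) y+y′<p p∣y+y′
    where
    y+y′<p : y + y′ < p
    y+y′<p = subst (y + y′ <_) (sym p≡4k+1) (s≤s (≤-trans (+-mono-≤ y≤H y′≤H) (≤-reflexive double-H)))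

  partner-unique : ∀ {x y y′} → Half x → Half y → Half y′ → Partners x y → Partners x y′ → y ≡ y′
  partner-unique {y = y} {y′} hx hy hy′ r r′ with ≤-total y y′
  partner-unique hx hy hy′ (inj₁ d) (inj₁ d′) | inj₁ y≤y′ = same-sign-unique 1 hx (proj₂ hy′) y≤y′ d d′
  partner-unique hx hy hy′ (inj₂ d) (inj₂ d′) | inj₁ y≤y′ = same-sign-unique (4 * k) hx (proj₂ hy′) y≤y′ d d′
  partner-unique hx hy hy′ (inj₁ d) (inj₁ d′) | inj₂ y′≤y = sym (same-sign-unique 1 hx (proj₂ hy) y′≤y d′ d)
  partner-unique hx hy hy′ (inj₂ d) (inj₂ d′) | inj₂ y′≤y = sym (same-sign-unique (4 * k) hx (proj₂ hy) y′≤y d′ d)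
  partner-unique hx hy hy′ (inj₁ d) (inj₂ d′) | _ = ⊥-elim (opposite-signs-impossible hx hy hy′ d d′)
  partner-unique hx hy hy′ (inj₂ d) (inj₁ d′) | _ = ⊥-elim (opposite-signs-impossible hx hy′ hy d′ d)

  -- A self-partner is 1 (x² ≡ 1 gives p ∣ (x − 1)(x + 1)) or a root of x² + 1.
  self-partner : ∀ x → Half x → Partners x x → x ≡ 1 ⊎ p ∣ x * x + 1
  self-partner x _ (inj₁ p∣x²+1) = inj₂ p∣x²+1
  self-partner (suc x) (_ , 1+x≤H) (inj₂ p∣x²+4k) with euclidsLemma x (x + 2) pp p∣x[x+2]
    where
    total : suc x * suc x + 4 * k ≡ p + x * (x + 2)
    total = trans (regroup x k) (cong (_+ x * (x + 2)) (sym p≡4k+1))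
      where
      regroup : ∀ x k → suc x * suc x + 4 * k ≡ suc (4 * k) + x * (x + 2)
      regroup = solve-∀
    p∣x[x+2] : p ∣ x * (x + 2)
    p∣x[x+2] = ∣m+n∣m⇒∣n (subst (p ∣_) total p∣x²+4k) ∣-refl
  ... | inj₁ p∣x   = inj₁ (cong suc (multiple-below p∣x (<-trans (n<1+n x) (≤-<-trans 1+x≤H H<p))))
  ... | inj₂ p∣x+2 = ⊥-elim (small-not-divisible (≤-trans z<s (m≤n+m 2 x)) x+2<p p∣x+2)
    where
    x+2<p : x + 2 < p
    x+2<p = subst (x + 2 <_) (sym p≡4k+1) (s≤s (begin
      x + 2      ≡⟨ +-comm x 2 ⟩
      2 + x      ≤⟨ s≤s 1+x≤H ⟩
      1 + H      ≤⟨ +-monoˡ-≤ H (≤-trans z<s 1+x≤H) ⟩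
      H + H      ≡⟨ double-H ⟩
      4 * k      ∎))
      where open ≤-Reasoning

  partner : ℕ → ℕ
  partner x = search (partners? x) H

  partner-spec : ∀ x → Half x → Half (partner x) × Partners x (partner x)
  partner-spec x hx with search-spec (partners? x) H (partner-exists x hx)
  ... | y>0 , y≤H , r = (y>0 , y≤H) , r

  partner-involution : Involution H partner
  partner-involution = record
    { maps-into  = λ x x>0 x≤H → proj₁ (partner-spec x (x>0 , x≤H))
    ; involutive = λ x x>0 x≤H →
        let hx = (x>0 , x≤H)
            (hy , r) = partner-spec x hx
            (hyy , r′) = partner-spec (partner x) hy
        in partner-unique hy hyy hx r′ (partners-sym {x} r) }

  -- The parity argument yields a fixed point x ≥ 2, and x² ≡ −1 (mod p).
  root : 0 < k → ∃[ r ] (p ∣ r * r + 1)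
  root k>0 with count≥2⇒witness (λ i → partner i ≟ i) H two-fixed
    where
    half-1 : Half 1
    half-1 = z<s , ≤-trans k>0 (m≤m+n k (k + 0))
    partner-1 : partner 1 ≡ 1
    partner-1 = let (h , r) = partner-spec 1 half-1 in
                partner-unique half-1 h half-1 r (inj₂ (subst (p ∣_) p≡4k+1 ∣-refl))
    one-fixed : 1 ≤ fixedCount partner H
    one-fixed = subst (λ n → 1 ≤ fixedCount partner n) (suc-pred H {{>-nonZero (proj₂ half-1)}})
                  (subst (1 ≤_) (sym (sum-shift (λ i → 𝟙 (partner i ≟ i)) (pred H)))
                    (≤-trans (≤-reflexive (sym (𝟙-yes (partner 1 ≟ 1) partner-1))) (m≤m+n _ _)))
    -- An odd count would contradict the parity of the involution on an even set.
    two-fixed : 2 ≤ fixedCount partner H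
    two-fixed with m≤n⇒m<n∨m≡n one-fixed | involution-parity H partner partner-involution
    ... | inj₁ 2≤count | _ = 2≤count
    ... | inj₂ 1≡count | t , count+H≡2t =
      ⊥-elim (odd≢even (trans (cong (_+ H) 1≡count) count+H≡2t))
      where
      odd≢even : ¬ (1 + 2 * k ≡ 2 * t)
      odd≢even e = 1+n≢0 {0} (begin
        1                  ≡⟨ [m+kn]%n≡m%n 1 k 2 ⟨
        (1 + k * 2) % 2    ≡⟨ cong (λ v → (1 + v) % 2) (*-comm k 2) ⟩
        (1 + 2 * k) % 2    ≡⟨ cong (_% 2) (trans e (*-comm 2 t)) ⟩
        (t * 2) % 2        ≡⟨ m*n%n≡0 t 2 ⟩
        0                  ∎)
        where open ≡-Reasoning
  ... | x , x≥2 , x≤H , fixed with self-partner x (≤-trans z<s x≥2 , x≤H)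
                                    (subst (Partners x) fixed (proj₂ (partner-spec x (≤-trans z<s x≥2 , x≤H))))
  ... | inj₁ refl      = ⊥-elim (<-irrefl refl x≥2)
  ... | inj₂ p∣x²+1 = x , p∣x²+1

sqrt-minus-one : ∀ {p} → Prime p → p % 4 ≡ 1 → ∃[ r ] (p ∣ r * r + 1)
sqrt-minus-one {p} pp p%4≡1 = SquareRootOfMinusOne.root p k pp p≡4k+1 k>0
  where
  k : ℕ
  k = p / 4
  p≡4k+1 : p ≡ suc (4 * k)
  p≡4k+1 = trans (m≡m%n+[m/n]*n p 4) (trans (cong (_+ k * 4) p%4≡1) (cong suc (*-comm k 4)))
  k>0 : 0 < k
  k>0 = n≢0⇒n>0 λ k≡0 → <⇒≢ (prime>1 pp) (sym (trans p≡4k+1 (cong (λ v → suc (4 * v)) k≡0)))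

-- Roots of x² + 1 modulo prime powers

-- If r² + 1 = s·Q with Q = pʲ⁺¹, choose t with s + 2r·t ≡ 0 (mod p); then
-- (r + t·Q)² + 1 = Q·(s + 2r·t) + t²·Q² is divisible by p·Q.
hensel-lift : ∀ {p} → Prime p → ¬ p ∣ 2 → ∃[ r ] (p ∣ r * r + 1) →
              ∀ j → ∃[ r ] (p ^ suc j ∣ r * r + 1)
hensel-lift {p} pp p∤2 (r , p∣r²+1) zero = r , subst (_∣ r * r + 1) (sym (*-identityʳ p)) p∣r²+1
hensel-lift {p} pp p∤2 base (suc j) with hensel-lift pp p∤2 base j
... | r , divides s r²+1≡sQ with linear-congruence pp p∤2r s
  where
  p∤2r : ¬ p ∣ 2 * r
  p∤2r p∣2r with euclidsLemma 2 r pp p∣2r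
  ... | inj₁ p∣2 = p∤2 p∣2
  ... | inj₂ p∣r = root-coprime (prime>1 pp) (∣-trans (∣m⇒∣m*n (p ^ j) ∣-refl) (divides s r²+1≡sQ)) p∣r
... | t , divides w s+2rt≡wp = r + t * Q , divides (w + t * t * p ^ j) (begin
      (r + t * Q) * (r + t * Q) + 1            ≡⟨ expand r t Q ⟩
      (r * r + 1) + Q * (2 * r * t) + t * t * Q * Q ≡⟨ cong (λ v → v + Q * (2 * r * t) + t * t * Q * Q) r²+1≡sQ ⟩
      s * Q + Q * (2 * r * t) + t * t * Q * Q  ≡⟨ factor s Q r t ⟩
      Q * (s + 2 * r * t) + t * t * Q * Q      ≡⟨ cong (λ v → Q * v + t * t * Q * Q) s+2rt≡wp ⟩
      Q * (w * p) + t * t * Q * Q              ≡⟨ collect w p (p ^ j) t ⟩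
      (w + t * t * p ^ j) * (p * (p * p ^ j))  ∎)
  where
  open ≡-Reasoning
  Q : ℕ
  Q = p * p ^ j
  expand : ∀ r t Q → (r + t * Q) * (r + t * Q) + 1 ≡ (r * r + 1) + Q * (2 * r * t) + t * t * Q * Q
  expand = solve-∀
  factor : ∀ s Q r t → s * Q + Q * (2 * r * t) + t * t * Q * Q ≡ Q * (s + 2 * r * t) + t * t * Q * Q
  factor = solve-∀
  collect : ∀ w p pʲ t → (p * pʲ) * (w * p) + t * t * (p * pʲ) * (p * pʲ) ≡ (w + t * t * pʲ) * (p * (p * pʲ))
  collect = solve-∀

difference-of-squares : ∀ {x y} → y ≤ x → x * x + 1 ≡ (y * y + 1) + (x ∸ y) * (x + y)
difference-of-squares {x} {y} y≤x =
  trans (cong (λ v → v * v + 1) x≡y+w)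
        (trans (expand y (x ∸ y)) (cong (λ v → (y * y + 1) + (x ∸ y) * (v + y)) (sym x≡y+w)))
  where
  x≡y+w : x ≡ y + (x ∸ y)
  x≡y+w = sym (m+[n∸m]≡n y≤x)
  expand : ∀ y w → (y + w) * (y + w) + 1 ≡ (y * y + 1) + w * ((y + w) + y)
  expand = solve-∀

-- Modulo a power Q of an odd prime, two roots x ≥ y of x² + 1 satisfy x ≡ ±y:
-- Q ∣ (x − y)(x + y), and p cannot divide both factors (it would divide 2x).
roots-± : ∀ {p} → Prime p → ¬ p ∣ 2 → ∀ j x y → y ≤ x →
          p ^ suc j ∣ x * x + 1 → p ^ suc j ∣ y * y + 1 → p ^ suc j ∣ x ∸ y ⊎ p ^ suc j ∣ x + y
roots-± {p} pp p∤2 j x y y≤x Q∣x²+1 Q∣y²+1 = split (p ∣? x + y) (p ∣? x ∸ y)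
  where
  Q∣product : p ^ suc j ∣ (x ∸ y) * (x + y)
  Q∣product = ∣m+n∣m⇒∣n (subst (p ^ suc j ∣_) (difference-of-squares y≤x) Q∣x²+1) Q∣y²+1
  sum≡2x : (x ∸ y) + (x + y) ≡ 2 * x
  sum≡2x = begin
    (x ∸ y) + (x + y)  ≡⟨ cong ((x ∸ y) +_) (+-comm x y) ⟩
    (x ∸ y) + (y + x)  ≡⟨ +-assoc (x ∸ y) y x ⟨
    (x ∸ y) + y + x    ≡⟨ cong (_+ x) (m∸n+n≡m y≤x) ⟩
    x + x              ≡⟨ cong (x +_) (+-identityʳ x) ⟨
    2 * x              ∎
    where open ≡-Reasoning
  split : Dec (p ∣ x + y) → Dec (p ∣ x ∸ y) → p ^ suc j ∣ x ∸ y ⊎ p ^ suc j ∣ x + y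
  split (no p∤x+y) _ = inj₁ (prime-power-cancel pp p∤x+y (suc j) (x ∸ y) Q∣product)
  split (yes _) (no p∤x-y) =
    inj₂ (prime-power-cancel pp p∤x-y (suc j) (x + y) (subst (p ^ suc j ∣_) (*-comm (x ∸ y) (x + y)) Q∣product))
  split (yes p∣x+y) (yes p∣x-y) with euclidsLemma 2 x pp (subst (p ∣_) sum≡2x (∣m∣n⇒∣m+n p∣x-y p∣x+y))
  ... | inj₁ p∣2 = ⊥-elim (p∤2 p∣2)
  ... | inj₂ p∣x = ⊥-elim (root-coprime (prime>1 pp) (∣-trans (∣m⇒∣m*n (p ^ j) ∣-refl) Q∣x²+1) p∣x)

rootCount : ℕ → ℕ → ℕ
rootCount Q n = sumTo (λ i → 𝟙 (Q ∣? i * i + 1)) n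

root-periodic : ∀ Q i → 𝟙 (Q ∣? (i + Q) * (i + Q) + 1) ≡ 𝟙 (Q ∣? i * i + 1)
root-periodic Q i = 𝟙-iff (Q ∣? (i + Q) * (i + Q) + 1) (Q ∣? i * i + 1)
  (λ Q∣ → ∣m+n∣m⇒∣n (subst (Q ∣_) (trans shift (+-comm (i * i + 1) _)) Q∣) (n∣m*n (2 * i + Q)))
  (λ Q∣ → subst (Q ∣_) (sym shift) (∣m∣n⇒∣m+n Q∣ (n∣m*n (2 * i + Q))))
  where
  shift : (i + Q) * (i + Q) + 1 ≡ (i * i + 1) + (2 * i + Q) * Q
  shift = expand i Q
    where
    expand : ∀ i Q → (i + Q) * (i + Q) + 1 ≡ (i * i + 1) + (2 * i + Q) * Q
    expand = solve-∀

root-mod : ∀ {Q} .{{_ : NonZero Q}} r → Q ∣ r * r + 1 → Q ∣ (r % Q) * (r % Q) + 1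
root-mod {Q} r Q∣r²+1 = ∣m+n∣m⇒∣n (subst (Q ∣_) split Q∣r²+1) (n∣m*n (d * (2 * (r % Q) + d * Q)))
  where
  d : ℕ
  d = r / Q
  split : r * r + 1 ≡ (d * (2 * (r % Q) + d * Q)) * Q + ((r % Q) * (r % Q) + 1)
  split = trans (cong (λ v → v * v + 1) (m≡m%n+[m/n]*n r Q)) (expand (r % Q) d Q)
    where
    expand : ∀ r d Q → (r + d * Q) * (r + d * Q) + 1 ≡ (d * (2 * r + d * Q)) * Q + (r * r + 1)
    expand = solve-∀

root-complement : ∀ {Q r} → r ≤ Q → Q ∣ r * r + 1 → Q ∣ (Q ∸ r) * (Q ∸ r) + 1
root-complement {Q} {r} r≤Q Q∣r²+1 =
  ∣m+n∣m⇒∣n {m = 2 * Q * r} (subst (Q ∣_) total (∣m∣n⇒∣m+n (∣m⇒∣m*n Q ∣-refl) Q∣r²+1))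
            (∣m⇒∣m*n r (n∣m*n 2))
  where
  total : Q * Q + (r * r + 1) ≡ 2 * Q * r + ((Q ∸ r) * (Q ∸ r) + 1)
  total = subst (λ v → v * v + (r * r + 1) ≡ 2 * v * r + ((Q ∸ r) * (Q ∸ r) + 1))
                (m∸n+n≡m r≤Q) (expand (Q ∸ r) r)
    where
    expand : ∀ s r → (s + r) * (s + r) + (r * r + 1) ≡ 2 * (s + r) * r + (s * s + 1)
    expand = solve-∀

-- Modulo Q = pʲ⁺¹ (p an odd prime) for which x² + 1 has a root, there are exactly
-- two roots r₀ and Q − r₀ in {1, …, Q}; by periodicity every block of Q
-- consecutive integers contains two roots.
module RootCount {p} (pp : Prime p) (p∤2 : ¬ p ∣ 2) (j : ℕ) (lifted : ∃[ r ] (p ^ suc j ∣ r * r + 1)) where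

  Q : ℕ
  Q = p ^ suc j

  instance
    Q≢0 : NonZero Q
    Q≢0 = m^n≢0 p (suc j) {{prime⇒nonZero pp}}

  -- Q > 1, so 0 is not a root.
  Q>1 : 1 < Q
  Q>1 = <-≤-trans (prime>1 pp) (≤-trans (≤-reflexive (sym (*-identityʳ p)))
                    (^-monoʳ-≤ p {{prime⇒nonZero pp}} {1} {suc j} (s≤s z≤n)))

  r₀ : ℕ
  r₀ = proj₁ lifted % Q

  r₀-root : Q ∣ r₀ * r₀ + 1
  r₀-root = root-mod (proj₁ lifted) (proj₂ lifted)

  r₀<Q : r₀ < Q
  r₀<Q = m%n<n (proj₁ lifted) Q

  r₀>0 : 0 < r₀
  r₀>0 = n≢0⇒n>0 λ r₀≡0 → <⇒≢ Q>1 (sym (∣1⇒≡1 (subst (λ v → Q ∣ v * v + 1) r₀≡0 r₀-root)))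

  s₀ : ℕ
  s₀ = Q ∸ r₀

  s₀-root : Q ∣ s₀ * s₀ + 1
  s₀-root = root-complement (<⇒≤ r₀<Q) r₀-root

  s₀>0 : 0 < s₀
  s₀>0 = m<n⇒0<n∸m r₀<Q

  -- The two roots differ, since Q = 2r₀ would make p ∣ 2r₀.
  r₀≢s₀ : r₀ ≢ s₀
  r₀≢s₀ r₀≡s₀ with euclidsLemma 2 r₀ pp (∣-trans (∣m⇒∣m*n (p ^ j) ∣-refl) (subst (Q ∣_) Q≡2r₀ ∣-refl))
    where
    Q≡2r₀ : Q ≡ 2 * r₀
    Q≡2r₀ = trans (sym (m∸n+n≡m (<⇒≤ r₀<Q))) (trans (cong (_+ r₀) (sym r₀≡s₀)) (cong (r₀ +_) (sym (+-identityʳ r₀))))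
  ... | inj₁ p∣2  = p∤2 p∣2
  ... | inj₂ p∣r₀ = root-coprime (prime>1 pp) (∣-trans (∣m⇒∣m*n (p ^ j) ∣-refl) r₀-root) p∣r₀

  close-congruent : ∀ {a b} → b ≤ a → 0 < b → a ≤ Q → Q ∣ a ∸ b → a ≡ b
  close-congruent {a} {b} b≤a b>0 a≤Q Q∣a-b =
    ≤-antisym (m∸n≡0⇒m≤n (multiple-below Q∣a-b (<-≤-trans (∸-monoʳ-< b>0 b≤a) a≤Q))) b≤a

  negative-of-r₀ : ∀ i → 0 < i → i ≤ Q → Q ∣ i + r₀ → i ≡ s₀
  negative-of-r₀ i i>0 i≤Q Q∣i+r₀ =
    trans (sym (m+n∸n≡m i r₀)) (cong (_∸ r₀) (multiple-below-double Q∣i+r₀ (≤-trans i>0 (m≤m+n i r₀)) i+r₀<2Q))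
    where
    i+r₀<2Q : i + r₀ < 2 * Q
    i+r₀<2Q = subst (i + r₀ <_) (cong (Q +_) (sym (+-identityʳ Q))) (+-mono-≤-< i≤Q r₀<Q)

  roots-in-period : ∀ i → 0 < i → i ≤ Q → Q ∣ i * i + 1 → i ≡ r₀ ⊎ i ≡ s₀
  roots-in-period i i>0 i≤Q Q∣i²+1 with ≤-total r₀ i
  ... | inj₁ r₀≤i = [ (λ Q∣i-r₀ → inj₁ (close-congruent r₀≤i r₀>0 i≤Q Q∣i-r₀))
                    , (λ Q∣i+r₀ → inj₂ (negative-of-r₀ i i>0 i≤Q Q∣i+r₀)) ]′
                    (roots-± pp p∤2 j i r₀ r₀≤i Q∣i²+1 r₀-root)
  ... | inj₂ i≤r₀ = [ (λ Q∣r₀-i → inj₁ (sym (close-congruent i≤r₀ i>0 (<⇒≤ r₀<Q) Q∣r₀-i)))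
                    , (λ Q∣r₀+i → inj₂ (negative-of-r₀ i i>0 i≤Q (subst (Q ∣_) (+-comm r₀ i) Q∣r₀+i))) ]′
                    (roots-± pp p∤2 j r₀ i i≤r₀ r₀-root Q∣i²+1)

  count-period : rootCount Q Q ≡ 2
  count-period = begin
    rootCount Q Q                                                 ≡⟨ sum-cong Q pointwise ⟩
    sumTo (λ i → 𝟙 (i ≟ r₀) + 𝟙 (i ≟ s₀)) Q                        ≡⟨ sum-+ (λ i → 𝟙 (i ≟ r₀)) (λ i → 𝟙 (i ≟ s₀)) Q ⟩
    sumTo (λ i → 𝟙 (i ≟ r₀)) Q + sumTo (λ i → 𝟙 (i ≟ s₀)) Q        ≡⟨ cong₂ _+_ (sum-point r₀ Q r₀>0 (<⇒≤ r₀<Q)) (sum-point s₀ Q s₀>0 (m∸n≤m Q r₀)) ⟩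
    2                                                             ∎
    where
    open ≡-Reasoning
    pointwise : ∀ i → 0 < i → i ≤ Q → 𝟙 (Q ∣? i * i + 1) ≡ 𝟙 (i ≟ r₀) + 𝟙 (i ≟ s₀)
    pointwise i i>0 i≤Q with Q ∣? i * i + 1
    ... | yes Q∣i²+1 with roots-in-period i i>0 i≤Q Q∣i²+1
    ...   | inj₁ i≡r₀ = sym (cong₂ _+_ (𝟙-yes (i ≟ r₀) i≡r₀) (𝟙-no (i ≟ s₀) λ i≡s₀ → r₀≢s₀ (trans (sym i≡r₀) i≡s₀)))
    ...   | inj₂ i≡s₀ = sym (cong₂ _+_ (𝟙-no (i ≟ r₀) λ i≡r₀ → r₀≢s₀ (trans (sym i≡r₀) i≡s₀)) (𝟙-yes (i ≟ s₀) i≡s₀))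
    pointwise i i>0 i≤Q | no Q∤i²+1 =
      sym (cong₂ _+_ (𝟙-no (i ≟ r₀) λ i≡r₀ → Q∤i²+1 (subst (λ v → Q ∣ v * v + 1) (sym i≡r₀) r₀-root))
                     (𝟙-no (i ≟ s₀) λ i≡s₀ → Q∤i²+1 (subst (λ v → Q ∣ v * v + 1) (sym i≡s₀) s₀-root)))

  count-formula : ∀ n → rootCount Q n ≡ rootCount Q (n % Q) + (n / Q) * 2
  count-formula n = begin
    rootCount Q n                                 ≡⟨ cong (rootCount Q) (m≡m%n+[m/n]*n n Q) ⟩
    rootCount Q (n % Q + (n / Q) * Q)             ≡⟨ sum-periodic _ Q (root-periodic Q) (n % Q) (n / Q) ⟩
    rootCount Q (n % Q) + (n / Q) * rootCount Q Q ≡⟨ cong (λ v → rootCount Q (n % Q) + (n / Q) * v) count-period ⟩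
    rootCount Q (n % Q) + (n / Q) * 2             ∎
    where open ≡-Reasoning

  -- Every complete period in {1, …, n} contributes two roots.
  count-lower : ∀ n → 2 * (n / Q) ≤ rootCount Q n
  count-lower n = subst (2 * (n / Q) ≤_) (sym (count-formula n))
                    (≤-trans (≤-reflexive (*-comm 2 (n / Q))) (m≤n+m _ _))

  -- No root i ≤ n exists when n² + 1 < Q.
  count-upper : ∀ n → rootCount Q n ≤ 2 * (n / Q) + 2 * 𝟙 (Q ≤? n * n + 1)
  count-upper n with Q ≤? n * n + 1
  ... | yes _ = begin
    rootCount Q n                             ≡⟨ count-formula n ⟩
    rootCount Q (n % Q) + (n / Q) * 2         ≤⟨ +-monoˡ-≤ ((n / Q) * 2) partial-period ⟩
    2 + (n / Q) * 2                           ≡⟨ cong (2 +_) (*-comm (n / Q) 2) ⟩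
    2 + 2 * (n / Q)                           ≡⟨ +-comm 2 _ ⟩
    2 * (n / Q) + 2                           ∎
    where
    open ≤-Reasoning
    partial-period : rootCount Q (n % Q) ≤ 2
    partial-period = subst (rootCount Q (n % Q) ≤_) count-period (sum-mono-range _ (m%n≤n n Q))
  ... | no Q≰n²+1 = ≤-trans (≤-reflexive (sum-zero _ n no-root)) z≤n
    where
    no-root : ∀ i → 0 < i → i ≤ n → 𝟙 (Q ∣? i * i + 1) ≡ 0
    no-root i _ i≤n = 𝟙-no (Q ∣? i * i + 1) λ Q∣i²+1 →
      Q≰n²+1 (≤-trans (∣⇒≤ {{subst NonZero (+-comm 1 (i * i)) _}} Q∣i²+1) (+-monoˡ-≤ 1 (*-mono-≤ i≤n i≤n)))

-- Exponents of a prime in products and least common multiples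

exponent-unique : ∀ {p m a b} → IsExponent p m a → IsExponent p m b → a ≡ b
exponent-unique {p} (pᵃ∣m , pᵃ⁺¹∤m) (pᵇ∣m , pᵇ⁺¹∤m) =
  ≤-antisym (≮⇒≥ λ b<a → pᵇ⁺¹∤m (∣-trans (pow∣pow p b<a) pᵃ∣m))
            (≮⇒≥ λ a<b → pᵃ⁺¹∤m (∣-trans (pow∣pow p a<b) pᵇ∣m))

decomposition : ∀ {p} → Prime p → ∀ m → 0 < m → ∃[ e ] ∃[ u ] (m ≡ p ^ e * u × ¬ p ∣ u)
decomposition {p} pp m m>0 = bounded m ≤-refl m>0
  where
  bounded : ∀ {F} m → m ≤ F → 0 < m → ∃[ e ] ∃[ u ] (m ≡ p ^ e * u × ¬ p ∣ u)
  bounded m m≤F m>0 with p ∣? m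
  ... | no p∤m = 0 , m , sym (+-identityʳ m) , p∤m
  bounded {zero}  m m≤0 m>0 | yes _ = ⊥-elim (<-irrefl refl (≤-trans m>0 m≤0))
  bounded {suc F} m m≤F m>0 | yes (divides c m≡cp) with bounded c c≤F c>0
    where
    c>0 : 0 < c
    c>0 = n≢0⇒n>0 λ { refl → <-irrefl (sym m≡cp) m>0 }
    c≤F : c ≤ F
    c≤F = ≤-pred (≤-trans (m<m*n c p {{>-nonZero c>0}} (prime>1 pp)) (≤-trans (≤-reflexive (sym m≡cp)) m≤F))
  ... | e , u , c≡pᵉu , p∤u = suc e , u , (begin
    m              ≡⟨ m≡cp ⟩
    c * p          ≡⟨ cong (_* p) c≡pᵉu ⟩
    p ^ e * u * p  ≡⟨ rotate (p ^ e) u p ⟩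
    p * p ^ e * u  ∎) , p∤u
    where
    open ≡-Reasoning
    rotate : ∀ a u p → a * u * p ≡ p * a * u
    rotate = solve-∀

power-bound : ∀ {p u} → Prime p → ¬ p ∣ u → ∀ j e → p ^ j ∣ p ^ e * u → j ≤ e
power-bound {p} {u} pp p∤u j e pʲ∣ = ≮⇒≥ λ e<j →
  p∤u (*-cancelˡ-∣ (p ^ e) {{m^n≢0 p e {{prime⇒nonZero pp}}}}
        (subst (_∣ p ^ e * u) (*-comm p (p ^ e)) (∣-trans (pow∣pow p e<j) pʲ∣)))

decomposition⇒exponent : ∀ {p u} → Prime p → ¬ p ∣ u → ∀ e → IsExponent p (p ^ e * u) e
decomposition⇒exponent pp p∤u e = ∣m⇒∣m*n _ ∣-refl , λ pᵉ⁺¹∣ → <-irrefl refl (power-bound pp p∤u (suc e) e pᵉ⁺¹∣)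

exponent⇒decomposition : ∀ {p m e} → IsExponent p m e → ∃[ u ] (m ≡ p ^ e * u × ¬ p ∣ u)
exponent⇒decomposition {p} {m} {e} (divides u m≡upᵉ , pᵉ⁺¹∤m) =
  u , trans m≡upᵉ (*-comm u (p ^ e)) , λ p∣u → pᵉ⁺¹∤m (subst (p ^ suc e ∣_) (sym m≡upᵉ) (p∣u⇒pᵉ⁺¹∣upᵉ p∣u))
  where
  p∣u⇒pᵉ⁺¹∣upᵉ : p ∣ u → p ^ suc e ∣ u * p ^ e
  p∣u⇒pᵉ⁺¹∣upᵉ p∣u = *-monoˡ-∣ (p ^ e) p∣u

exponent-* : ∀ {p a b e f} → Prime p → IsExponent p a e → IsExponent p b f → IsExponent p (a * b) (e + f)
exponent-* {p} {a} {b} {e} {f} pp exp-a exp-b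
  with exponent⇒decomposition {p} {a} {e} exp-a | exponent⇒decomposition {p} {b} {f} exp-b
... | u , a≡pᵉu , p∤u | v , b≡pᶠv , p∤v =
  subst (λ m → IsExponent p m (e + f)) (sym ab≡) (decomposition⇒exponent pp p∤uv (e + f))
  where
  p∤uv : ¬ p ∣ u * v
  p∤uv p∣uv = [ p∤u , p∤v ]′ (euclidsLemma u v pp p∣uv)
  ab≡ : a * b ≡ p ^ (e + f) * (u * v)
  ab≡ = begin
    a * b                    ≡⟨ cong₂ _*_ a≡pᵉu b≡pᶠv ⟩
    p ^ e * u * (p ^ f * v)  ≡⟨ interchange (p ^ e) u (p ^ f) v ⟩
    p ^ e * p ^ f * (u * v)  ≡⟨ cong (_* (u * v)) (^-distribˡ-+-* p e f) ⟨
    p ^ (e + f) * (u * v)    ∎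
    where
    open ≡-Reasoning
    interchange : ∀ a b c d → a * b * (c * d) ≡ a * c * (b * d)
    interchange = solve-∀

-- The exponent as a count:  v_p(m) = #{ 1 ≤ j ≤ J : pʲ ∣ m }  whenever m ≤ J.
divisorCount : ℕ → ℕ → ℕ → ℕ
divisorCount p J m = sumTo (λ j → 𝟙 (p ^ j ∣? m)) J

count-initial-segment : ∀ e J → e ≤ J → sumTo (λ j → 𝟙 (j ≤? e)) J ≡ e
count-initial-segment e J e≤J rewrite sym (m+[n∸m]≡n e≤J) = beyond (J ∸ e)
  where
  upto : ∀ i → i ≤ e → sumTo (λ j → 𝟙 (j ≤? e)) i ≡ i
  upto zero    _     = refl
  upto (suc i) 1+i≤e rewrite upto i (≤-trans (n≤1+n i) 1+i≤e) | 𝟙-yes (suc i ≤? e) 1+i≤e = +-comm i 1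
  beyond : ∀ d → sumTo (λ j → 𝟙 (j ≤? e)) (e + d) ≡ e
  beyond zero    rewrite +-identityʳ e = upto e ≤-refl
  beyond (suc d) rewrite +-suc e d | beyond d
                       | 𝟙-no (suc (e + d) ≤? e) (λ le → <⇒≱ (s≤s (m≤m+n e d)) le) = +-identityʳ e

exponent-count : ∀ {p} → Prime p → ∀ m J → 0 < m → m ≤ J → IsExponent p m (divisorCount p J m)
exponent-count {p} pp m J m>0 m≤J with decomposition pp m m>0
... | e , u , m≡pᵉu , p∤u =
  subst (IsExponent p m) (sym count≡e) (subst (λ v → IsExponent p v e) (sym m≡pᵉu) (decomposition⇒exponent pp p∤u e))
  where
  e<m : e < m
  e<m = <-≤-trans (n<m^n p (prime>1 pp) e)
          (∣⇒≤ {{>-nonZero m>0}} (subst (p ^ e ∣_) (sym m≡pᵉu) (∣m⇒∣m*n u ∣-refl)))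
  count≡e : divisorCount p J m ≡ e
  count≡e = trans (sum-cong J pointwise) (count-initial-segment e J (≤-trans (<⇒≤ e<m) m≤J))
    where
    pointwise : ∀ j → 0 < j → j ≤ J → 𝟙 (p ^ j ∣? m) ≡ 𝟙 (j ≤? e)
    pointwise j _ _ = 𝟙-iff (p ^ j ∣? m) (j ≤? e)
      (λ pʲ∣m → power-bound pp p∤u j e (subst (p ^ j ∣_) m≡pᵉu pʲ∣m))
      (lower-power-divides p m≡pᵉu)

exponent-P : ∀ {p} → Prime p → ∀ J n → n ^ 2 + 1 ≤ J →
             IsExponent p (P n) (sumTo (λ i → divisorCount p J (i ^ 2 + 1)) n)
exponent-P pp J zero    _ = ∣-refl , λ p∣1 → <⇒≢ (prime>1 pp) (sym (∣1⇒≡1 (subst (_∣ 1) (*-identityʳ _) p∣1)))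
exponent-P {p} pp J (suc n) bound =
  exponent-* {a = P n} {e = sumTo (λ i → divisorCount p J (i ^ 2 + 1)) n} pp
    (exponent-P pp J n (≤-trans (+-monoˡ-≤ 1 (^-monoˡ-≤ 2 (n≤1+n n))) bound))
    (exponent-count pp (suc n ^ 2 + 1) J (m≤n+m 1 (suc n ^ 2)) bound)

prime-power-lcm-cofactor : ∀ {p a b a′ i} → Prime p → a ≡ p ^ i * a′ → ¬ p ∣ a′ → p ^ i ∣ b →
                           ∀ k → p ^ k ∣ lcm a b → p ^ k ∣ b
prime-power-lcm-cofactor {p} {a} {b} {a′} {i} pp a≡pⁱa′ p∤a′ pⁱ∣b k pᵏ∣lcm =
  prime-power-cancel pp p∤a′ k b (subst (p ^ k ∣_) (*-comm a′ b) (∣-trans pᵏ∣lcm (lcm-least a∣a′b (n∣m*n a′))))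
  where
  a∣a′b : a ∣ a′ * b
  a∣a′b = subst (_∣ a′ * b) (trans (*-comm a′ (p ^ i)) (sym a≡pⁱa′)) (*-monoʳ-∣ a′ pⁱ∣b)

-- A prime power dividing lcm(a, b) divides a or b: compare the exponents of p in a
-- and b, and apply the previous lemma to lcm(a, b) or to lcm(b, a).
prime-power-lcm : ∀ {p} → Prime p → ∀ k a b → p ^ k ∣ lcm a b → p ^ k ∣ a ⊎ p ^ k ∣ b
prime-power-lcm pp k zero    b _ = inj₁ (_ ∣0)
prime-power-lcm pp k (suc a) zero _ = inj₂ (_ ∣0)
prime-power-lcm {p} pp k a@(suc _) b@(suc _) pᵏ∣lcm
  with decomposition pp a z<s | decomposition pp b z<s
... | i , a′ , a≡pⁱa′ , p∤a′ | j , b′ , b≡pʲb′ , p∤b′ with ≤-total i j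
...   | inj₁ i≤j = inj₂ (prime-power-lcm-cofactor {i = i} pp a≡pⁱa′ p∤a′ (lower-power-divides p b≡pʲb′ i≤j) k pᵏ∣lcm)
...   | inj₂ j≤i = inj₁ (prime-power-lcm-cofactor {i = j} pp b≡pʲb′ p∤b′ (lower-power-divides p a≡pⁱa′ j≤i) k
                                                  (subst (p ^ k ∣_) (lcm-comm a b) pᵏ∣lcm))

-- Legendre-type sums, logarithms and a growth inequality

⌊_/_^_⌋ : ℕ → (p : ℕ) .{{_ : NonZero p}} → ℕ → ℕ
⌊ n / p ^ j ⌋ = _/_ n (p ^ j) {{m^n≢0 p j}}

legendreSum : (p : ℕ) .{{_ : NonZero p}} → ℕ → ℕ → ℕ
legendreSum p J n = sumTo (λ j → ⌊ n / p ^ j ⌋) J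

-- ⌊n / pʲ⁺¹⌋ = ⌊⌊n/p⌋ / pʲ⌋, so the sum for n is ⌊n/p⌋ plus the sum for ⌊n/p⌋.
legendreSum-step : ∀ q J n → legendreSum (suc q) (suc J) n ≡ n / suc q + legendreSum (suc q) J (n / suc q)
legendreSum-step q J n = trans (sum-shift _ J) (cong₂ _+_ first (sum-cong J λ j _ _ → nested j))
  where
  first : ⌊ n / suc q ^ 1 ⌋ ≡ n / suc q
  first = /-congʳ {m = n} {{m^n≢0 (suc q) 1}} (*-identityʳ (suc q))
  nested : ∀ j → ⌊ n / suc q ^ suc j ⌋ ≡ ⌊ (n / suc q) / suc q ^ j ⌋
  nested j = sym (m/n/o≡m/[n*o] n (suc q) (suc q ^ j) {{_}} {{m^n≢0 (suc q) j}} {{m^n≢0 (suc q) (suc j)}})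

legendre-upper : ∀ q J n → q * legendreSum (suc q) J n ≤ n
legendre-upper q zero    n = subst (_≤ n) (sym (*-zeroʳ q)) z≤n
legendre-upper q (suc J) n = begin
  q * legendreSum (suc q) (suc J) n   ≡⟨ cong (q *_) (legendreSum-step q J n) ⟩
  q * (m + legendreSum (suc q) J m)   ≡⟨ *-distribˡ-+ q m _ ⟩
  q * m + q * legendreSum (suc q) J m ≤⟨ +-monoʳ-≤ (q * m) (legendre-upper q J m) ⟩
  q * m + m                           ≡⟨ +-comm (q * m) m ⟩
  suc q * m                           ≡⟨ *-comm (suc q) m ⟩
  m * suc q                           ≤⟨ m/n*n≤m n (suc q) ⟩
  n                                   ∎
  where
  open ≤-Reasoning
  m : ℕ
  m = n / suc q

-- With p = q + 1:  n ≤ q · Σ_{j=1}^{J} ⌊n/pʲ⌋ + q·J + ⌊n/pᴶ⌋  (each division loses at most q).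
legendre-lower : ∀ q J n → n ≤ q * legendreSum (suc q) J n + q * J + ⌊ n / suc q ^ J ⌋
legendre-lower q zero n = ≤-reflexive (begin-equality
  n                ≡⟨ n/1≡n n ⟨
  n / 1            ≡⟨ cong₂ (λ a b → a + b + n / 1) (*-zeroʳ q) (*-zeroʳ q) ⟨
  q * 0 + q * 0 + n / 1 ∎)
  where open ≤-Reasoning
legendre-lower q (suc J) n = begin
  n                                            ≡⟨ m≡m%n+[m/n]*n n (suc q) ⟩
  n % suc q + m * suc q                        ≡⟨ regroup (n % suc q) m q ⟩
  n % suc q + q * m + m                        ≤⟨ +-mono-≤ (+-monoˡ-≤ (q * m) remainder≤q) (legendre-lower q J m) ⟩
  q + q * m + (q * S + q * J + T)              ≡⟨ collect q m S J T ⟩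
  q * (m + S) + q * suc J + T                  ≡⟨ cong₂ (λ a b → q * a + q * suc J + b) (sym (legendreSum-step q J n)) nested ⟩
  q * legendreSum (suc q) (suc J) n + q * suc J + ⌊ n / suc q ^ suc J ⌋ ∎
  where
  open ≤-Reasoning
  m : ℕ
  m = n / suc q
  S : ℕ
  S = legendreSum (suc q) J m
  T : ℕ
  T = ⌊ m / suc q ^ J ⌋
  remainder≤q : n % suc q ≤ q
  remainder≤q = ≤-pred (m%n<n n (suc q))
  nested : T ≡ ⌊ n / suc q ^ suc J ⌋
  nested = m/n/o≡m/[n*o] n (suc q) (suc q ^ J) {{_}} {{m^n≢0 (suc q) J}} {{m^n≢0 (suc q) (suc J)}}
  regroup : ∀ r m q → r + m * suc q ≡ r + q * m + m
  regroup = solve-∀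
  collect : ∀ q m S J T → q + q * m + (q * S + q * J + T) ≡ q * (m + S) + q * suc J + T
  collect = solve-∀

floor-log : ∀ p → 1 < p → ∀ n → 1 ≤ n → ∃[ J ] (p ^ J ≤ n × n < p ^ suc J)
floor-log p p>1 n n≥1 = bounded n ≤-refl n≥1
  where
  instance _ = >-nonZero (<-trans z<s p>1)
  bounded : ∀ {F} n → n ≤ F → 1 ≤ n → ∃[ J ] (p ^ J ≤ n × n < p ^ suc J)
  bounded n n≤F n≥1 with n <? p
  ... | yes n<p = 0 , n≥1 , subst (n <_) (sym (*-identityʳ p)) n<p
  bounded {zero}  n n≤0 n≥1 | no _ = ⊥-elim (<-irrefl refl (≤-trans n≥1 n≤0))
  bounded {suc F} n n≤F n≥1 | no n≮p with bounded (n / p) m≤F (m≥n⇒m/n>0 (≮⇒≥ n≮p))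
    where
    m≤F : n / p ≤ F
    m≤F = ≤-pred (≤-trans (m/n<m n p {{>-nonZero n≥1}} p>1) n≤F)
  ... | J , pᴶ≤m , m<pᴶ⁺¹ = suc J , lower , upper
    where
    open ≤-Reasoning
    m : ℕ
    m = n / p
    lower : p ^ suc J ≤ n
    lower = begin
      p * p ^ J  ≤⟨ *-monoʳ-≤ p pᴶ≤m ⟩
      p * m      ≡⟨ *-comm p m ⟩
      m * p      ≤⟨ m/n*n≤m n p ⟩
      n          ∎
    upper : n < p * p ^ suc J
    upper = begin-strict
      n               ≡⟨ m≡m%n+[m/n]*n n p ⟩
      n % p + m * p   <⟨ +-monoˡ-< (m * p) (m%n<n n p) ⟩
      p + m * p       ≡⟨ *-comm (suc m) p ⟩
      p * suc m       ≤⟨ *-monoʳ-≤ p m<pᴶ⁺¹ ⟩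
      p * p ^ suc J   ∎

smallPowers : ℕ → ℕ → ℕ → ℕ
smallPowers p M J = sumTo (λ j → 𝟙 (p ^ j ≤? M)) J

-- These j form an initial segment {1, …, K}, so pᴷ ≤ M.  The invariant carried
-- along is that either all of 1, …, J are counted or M < pᴶ already.
smallPowers-bound : ∀ p → 0 < p → ∀ M → 1 ≤ M → ∀ J → p ^ smallPowers p M J ≤ M
smallPowers-bound p p>0 M M≥1 J = proj₁ (invariant J)
  where
  instance _ = >-nonZero p>0
  invariant : ∀ J → p ^ smallPowers p M J ≤ M × (smallPowers p M J ≡ J ⊎ M < p ^ J)
  invariant zero    = M≥1 , inj₁ refl
  invariant (suc J) with invariant J | p ^ suc J ≤? M
  ... | _ , inj₂ M<pᴶ | yes pᴶ⁺¹≤M = ⊥-elim (<⇒≱ M<pᴶ (≤-trans (^-monoʳ-≤ p (n≤1+n J)) pᴶ⁺¹≤M))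
  ... | _ , inj₁ K≡J  | yes pᴶ⁺¹≤M = subst (λ v → p ^ v ≤ M) (sym K+1≡J+1) pᴶ⁺¹≤M , inj₁ K+1≡J+1
    where
    K+1≡J+1 : smallPowers p M J + 1 ≡ suc J
    K+1≡J+1 = trans (cong (_+ 1) K≡J) (+-comm J 1)
  ... | pᴷ≤M , _      | no pᴶ⁺¹≰M =
    subst (λ v → p ^ v ≤ M) (sym (+-identityʳ (smallPowers p M J))) pᴷ≤M , inj₂ (≰⇒> pᴶ⁺¹≰M)

-- Growth:  mⁿ ≤ n²ᵐ  for 2 ≤ n ≤ m.  With nᵃ ≤ m < nᵃ⁺¹ (a ≥ 1) we have
-- mⁿ ≤ n^((a+1)·n), and (a + 1)·n ≤ 2·2ᵃ⁻¹·n ≤ 2·nᵃ ≤ 2m.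
growth : ∀ n m → 2 ≤ n → n ≤ m → m ^ n ≤ n ^ (2 * m)
growth n m n≥2 n≤m with floor-log n n≥2 m (≤-trans (≤-trans (s≤s z≤n) n≥2) n≤m)
... | zero , _ , m<n¹ = ⊥-elim (<⇒≱ (subst (m <_) (*-identityʳ n) m<n¹) n≤m)
... | suc b , nᵃ≤m , m<nᵃ⁺¹ = begin
  m ^ n                   ≤⟨ ^-monoˡ-≤ n (<⇒≤ m<nᵃ⁺¹) ⟩
  (n ^ suc (suc b)) ^ n   ≡⟨ ^-*-assoc n (suc (suc b)) n ⟩
  n ^ (suc (suc b) * n)   ≤⟨ ^-monoʳ-≤ n exponent-bound ⟩
  n ^ (2 * m)             ∎
  where
  open ≤-Reasoning
  instance _ = >-nonZero (≤-trans (s≤s z≤n) n≥2)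
  exponent-bound : suc (suc b) * n ≤ 2 * m
  exponent-bound = begin
    suc (suc b) * n    ≤⟨ *-monoˡ-≤ n (n<m^n 2 ≤-refl (suc b)) ⟩
    (2 * 2 ^ b) * n    ≤⟨ *-monoˡ-≤ n (*-monoʳ-≤ 2 (^-monoˡ-≤ b n≥2)) ⟩
    (2 * n ^ b) * n    ≡⟨ *-assoc 2 (n ^ b) n ⟩
    2 * (n ^ b * n)    ≡⟨ cong (2 *_) (*-comm (n ^ b) n) ⟩
    2 * n ^ suc b      ≤⟨ *-monoʳ-≤ 2 nᵃ≤m ⟩
    2 * m              ∎

square : ∀ i → i ^ 2 ≡ i * i
square i = cong (i *_) (*-identityʳ i)

n²+1≤n³ : ∀ {n} → 2 ≤ n → n * n + 1 ≤ n ^ 3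
n²+1≤n³ {n} n≥2 = begin
  n * n + 1      ≤⟨ +-monoʳ-≤ (n * n) (*-mono-≤ n≥1 n≥1) ⟩
  n * n + n * n  ≡⟨ cong (n * n +_) (+-identityʳ (n * n)) ⟨
  2 * (n * n)    ≤⟨ *-monoˡ-≤ (n * n) n≥2 ⟩
  n * (n * n)    ≡⟨ cong (λ v → n * (n * v)) (*-identityʳ n) ⟨
  n ^ 3          ∎
  where
  open ≤-Reasoning
  n≥1 : 1 ≤ n
  n≥1 = ≤-trans (s≤s z≤n) n≥2

n≤n²+1 : ∀ n → n ≤ n ^ 2 + 1
n≤n²+1 zero    = z≤n
n≤n²+1 (suc n) = ≤-trans (m≤m*n (suc n) (suc n)) (≤-trans (≤-reflexive (sym (square (suc n)))) (m≤m+n _ 1))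

prime-power-L : ∀ {p} → Prime p → ∀ k n → p ^ k ∣ L n →
                p ^ k ∣ 1 ⊎ ∃[ i ] (0 < i × i ≤ n × p ^ k ∣ i ^ 2 + 1)
prime-power-L pp k zero    pᵏ∣1 = inj₁ pᵏ∣1
prime-power-L pp k (suc n) pᵏ∣L with prime-power-lcm pp k (L n) (suc n ^ 2 + 1) pᵏ∣L
... | inj₂ pᵏ∣t = inj₂ (suc n , z<s , ≤-refl , pᵏ∣t)
... | inj₁ pᵏ∣Lₙ with prime-power-L pp k n pᵏ∣Lₙ
...   | inj₁ pᵏ∣1                  = inj₁ pᵏ∣1
...   | inj₂ (i , i>0 , i≤n , pᵏ∣t) = inj₂ (i , i>0 , m≤n⇒m≤1+n i≤n , pᵏ∣t)

exponent-L-bound : ∀ (n p β : ℕ) → 2 ≤ n → Prime p → IsExponent p (L n) β → p ^ β ≤ n ^ 3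
exponent-L-bound n p β n≥2 pp (p^β∣L , _) with prime-power-L pp β n p^β∣L
... | inj₁ p^β∣1 = ≤-trans (∣⇒≤ p^β∣1) (^-monoˡ-≤ 3 (≤-trans (s≤s z≤n) n≥2))
... | inj₂ (i , _ , i≤n , p^β∣t) = begin
  p ^ β       ≤⟨ ∣⇒≤ {{subst NonZero (+-comm 1 (i ^ 2)) _}} p^β∣t ⟩
  i ^ 2 + 1   ≤⟨ +-monoˡ-≤ 1 (^-monoˡ-≤ 2 i≤n) ⟩
  n ^ 2 + 1   ≡⟨ cong (_+ 1) (square n) ⟩
  n * n + 1   ≤⟨ n²+1≤n³ n≥2 ⟩
  n ^ 3       ∎
  where open ≤-Reasoning

module ExponentInP {q} (pp : Prime (suc q)) (p%4≡1 : suc q % 4 ≡ 1) (n : ℕ) where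

  p : ℕ
  p = suc q

  -- All exponents v_p(i² + 1), i ≤ n, are counted by pʲ with j ≤ Jₙ.
  Jₙ : ℕ
  Jₙ = n ^ 2 + 1

  N : ℕ → ℕ
  N j = rootCount (p ^ j) n

  α : ℕ
  α = sumTo N Jₙ

  -- α = Σ_{j=1}^{Jₙ} Nⱼ is the exponent: count the pairs (i, j) with pʲ ∣ i² + 1 both ways.
  exponent-as-count : IsExponent p (P n) α
  exponent-as-count = subst (IsExponent p (P n)) double-count (exponent-P pp Jₙ n ≤-refl)
    where
    double-count : sumTo (λ i → divisorCount p Jₙ (i ^ 2 + 1)) n ≡ α
    double-count = trans (sum-swap (λ i j → 𝟙 (p ^ j ∣? i ^ 2 + 1)) n Jₙ)
      (sum-cong Jₙ λ j _ _ → sum-cong n λ i _ _ → cong (λ v → 𝟙 (p ^ j ∣? v + 1)) (square i))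

  N-bounds : ∀ j → 0 < j → 2 * ⌊ n / p ^ j ⌋ ≤ N j × N j ≤ 2 * ⌊ n / p ^ j ⌋ + 2 * 𝟙 (p ^ j ≤? n * n + 1)
  N-bounds (suc j) _ = count-lower n , count-upper n
    where
    p∤2 : ¬ p ∣ 2
    p∤2 = prime≡1mod4⇒∤2 pp p%4≡1
    open RootCount pp p∤2 j (hensel-lift pp p∤2 (sqrt-minus-one pp p%4≡1) j)

  K : ℕ
  K = smallPowers p (n * n + 1) Jₙ

  exponent-upper : q * α ≤ 2 * n + 2 * q * K
  exponent-upper = begin
    q * α                                           ≤⟨ *-monoʳ-≤ q (sum-mono Jₙ λ j j>0 _ → proj₂ (N-bounds j j>0)) ⟩
    q * sumTo (λ j → 2 * D j + 2 * small j) Jₙ      ≡⟨ cong (q *_) (sum-+ (λ j → 2 * D j) (λ j → 2 * small j) Jₙ) ⟩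
    q * (sumTo (λ j → 2 * D j) Jₙ + sumTo (λ j → 2 * small j) Jₙ)
                                                    ≡⟨ cong₂ (λ a b → q * (a + b)) (sum-* 2 D Jₙ) (sum-* 2 small Jₙ) ⟩
    q * (2 * legendreSum p Jₙ n + 2 * K)            ≡⟨ distribute q (legendreSum p Jₙ n) K ⟩
    2 * (q * legendreSum p Jₙ n) + 2 * q * K        ≤⟨ +-monoˡ-≤ (2 * q * K) (*-monoʳ-≤ 2 (legendre-upper q Jₙ n)) ⟩
    2 * n + 2 * q * K                               ∎
    where
    open ≤-Reasoning
    D : ℕ → ℕ
    D j = ⌊ n / p ^ j ⌋
    small : ℕ → ℕ
    small j = 𝟙 (p ^ j ≤? n * n + 1)
    distribute : ∀ q S K → q * (2 * S + 2 * K) ≡ 2 * (q * S) + 2 * q * K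
    distribute = solve-∀

  exponent-lower : ∀ J₀ → p ^ J₀ ≤ n → n < p ^ suc J₀ → 2 * n ≤ q * α + 2 * q * suc J₀
  exponent-lower J₀ pᴶ⁰≤n n<pᴶ⁰⁺¹ = begin
    2 * n                                        ≤⟨ *-monoʳ-≤ 2 (legendre-lower q J₀ n) ⟩
    2 * (q * S + q * J₀ + ⌊ n / p ^ J₀ ⌋)        ≤⟨ *-monoʳ-≤ 2 (+-monoʳ-≤ (q * S + q * J₀) last-term) ⟩
    2 * (q * S + q * J₀ + q)                     ≡⟨ distribute q S J₀ ⟩
    q * (2 * S) + 2 * q * suc J₀                 ≤⟨ +-monoˡ-≤ (2 * q * suc J₀) (*-monoʳ-≤ q twice-S≤α) ⟩
    q * α + 2 * q * suc J₀                       ∎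
    where
    open ≤-Reasoning
    S : ℕ
    S = legendreSum p J₀ n
    last-term : ⌊ n / p ^ J₀ ⌋ ≤ q
    last-term = ≤-pred (m<n*o⇒m/o<n {n} {p} {p ^ J₀} {{m^n≢0 p J₀}} n<pᴶ⁰⁺¹)
    J₀≤Jₙ : J₀ ≤ Jₙ
    J₀≤Jₙ = ≤-trans (<⇒≤ (<-≤-trans (n<m^n p (prime>1 pp) J₀) pᴶ⁰≤n)) (n≤n²+1 n)
    twice-S≤α : 2 * S ≤ α
    twice-S≤α = begin
      2 * S                               ≡⟨ sum-* 2 (λ j → ⌊ n / p ^ j ⌋) J₀ ⟨
      sumTo (λ j → 2 * ⌊ n / p ^ j ⌋) J₀  ≤⟨ sum-mono J₀ (λ j j>0 _ → proj₁ (N-bounds j j>0)) ⟩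
      sumTo N J₀                          ≤⟨ sum-mono-range N J₀≤Jₙ ⟩
      α                                   ∎
    distribute : ∀ q S j → 2 * (q * S + q * j + q) ≡ q * (2 * S) + 2 * q * suc j
    distribute = solve-∀

power-from-exponent : ∀ p b c {d B} .{{_ : NonZero p}} → d ≤ c * b → p ^ b ≤ B → p ^ d ≤ B ^ c
power-from-exponent p b c {d} {B} d≤cb pᵇ≤B = begin
  p ^ d        ≤⟨ ^-monoʳ-≤ p (≤-trans d≤cb (≤-reflexive (*-comm c b))) ⟩
  p ^ (b * c)  ≡⟨ ^-*-assoc p b c ⟨
  (p ^ b) ^ c  ≤⟨ ^-monoˡ-≤ c pᵇ≤B ⟩
  B ^ c        ∎
  where open ≤-Reasoning

cube-power : ∀ {n B} q → 2 ≤ n → B ≤ n ^ 3 → B ^ (2 * q) ≤ n ^ (8 * q)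
cube-power {n} {B} q n≥2 B≤n³ = begin
  B ^ (2 * q)        ≤⟨ ^-monoˡ-≤ (2 * q) B≤n³ ⟩
  (n ^ 3) ^ (2 * q)  ≡⟨ ^-*-assoc n 3 (2 * q) ⟩
  n ^ (3 * (2 * q))  ≤⟨ ^-monoʳ-≤ n (≤-trans (≤-reflexive (sym (*-assoc 3 2 q))) (*-monoˡ-≤ q (m≤m+n 6 2))) ⟩
  n ^ (8 * q)        ∎
  where
  open ≤-Reasoning
  instance _ = >-nonZero (≤-trans z<s n≥2)

module ExponentInPBounds {q} (pp : Prime (suc q)) (p%4≡1 : suc q % 4 ≡ 1) {n} (n≥2 : 2 ≤ n) where
  open ExponentInP pp p%4≡1 n

  instance _ = >-nonZero (≤-trans z<s n≥2)

  excess-bound : p ^ (q * α ∸ 2 * n) ≤ n ^ (8 * q)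
  excess-bound = ≤-trans (power-from-exponent p K (2 * q) excess≤2qK pᴷ≤n²+1) (cube-power q n≥2 (n²+1≤n³ n≥2))
    where
    excess≤2qK : q * α ∸ 2 * n ≤ 2 * q * K
    excess≤2qK = m≤n+o⇒m∸n≤o (q * α) (2 * n) exponent-upper
    pᴷ≤n²+1 : p ^ K ≤ n * n + 1
    pᴷ≤n²+1 = smallPowers-bound p z<s (n * n + 1) (m≤n+m 1 (n * n)) Jₙ

  -- For p ≤ n:  2n − q·α ≤ 2q·(J₀ + 1) with p^(J₀+1) ≤ p·n ≤ n².
  deficit-bound-small-p : p ≤ n → p ^ (2 * n ∸ q * α) ≤ n ^ (8 * q)
  deficit-bound-small-p p≤n with floor-log p (prime>1 pp) n (≤-trans z<s n≥2)
  ... | J₀ , pᴶ⁰≤n , n<pᴶ⁰⁺¹ =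
    ≤-trans (power-from-exponent p (suc J₀) (2 * q) deficit≤2q[J₀+1] (*-mono-≤ p≤n pᴶ⁰≤n))
            (cube-power q n≥2 (≤-trans (m≤m+n (n * n) 1) (n²+1≤n³ n≥2)))
    where
    deficit≤2q[J₀+1] : 2 * n ∸ q * α ≤ 2 * q * suc J₀
    deficit≤2q[J₀+1] = m≤n+o⇒m∸n≤o (2 * n) (q * α) (exponent-lower J₀ pᴶ⁰≤n n<pᴶ⁰⁺¹)

  -- For p > n:  p^(2n − qα) ≤ (pⁿ)² ≤ (n^(2p))² = n^(4p) ≤ n^(8q).
  deficit-bound-large-p : n < p → p ^ (2 * n ∸ q * α) ≤ n ^ (8 * q)
  deficit-bound-large-p n<p = begin
    p ^ (2 * n ∸ q * α)   ≤⟨ power-from-exponent p n 2 (m∸n≤m (2 * n) (q * α)) (growth n p n≥2 (<⇒≤ n<p)) ⟩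
    (n ^ (2 * p)) ^ 2     ≡⟨ ^-*-assoc n (2 * p) 2 ⟩
    n ^ (2 * p * 2)       ≤⟨ ^-monoʳ-≤ n 4p≤8q ⟩
    n ^ (8 * q)           ∎
    where
    open ≤-Reasoning
    4p≤8q : 2 * p * 2 ≤ 8 * q
    4p≤8q = begin
      2 * p * 2      ≡⟨ expand q ⟩
      4 + 4 * q      ≤⟨ +-monoˡ-≤ (4 * q) (*-monoʳ-≤ 4 (≤-pred (prime>1 pp))) ⟩
      4 * q + 4 * q  ≡⟨ double q ⟩
      8 * q          ∎
      where
      expand : ∀ q → 2 * suc q * 2 ≡ 4 + 4 * q
      expand = solve-∀
      double : ∀ q → 4 * q + 4 * q ≡ 8 * q
      double = solve-∀

  deficit-bound : p ^ (2 * n ∸ q * α) ≤ n ^ (8 * q)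
  deficit-bound with p ≤? n
  ... | yes p≤n = deficit-bound-small-p p≤n
  ... | no p≰n  = deficit-bound-large-p (≰⇒> p≰n)

  distance-bound : p ^ ∣ q * α - 2 * n ∣ ≤ n ^ (8 * q)
  distance-bound with ≤-total (2 * n) (q * α)
  ... | inj₁ 2n≤qα = subst (λ d → p ^ d ≤ n ^ (8 * q))
                       (sym (trans (∣-∣-comm (q * α) (2 * n)) (m≤n⇒∣m-n∣≡n∸m 2n≤qα))) excess-bound
  ... | inj₂ qα≤2n = subst (λ d → p ^ d ≤ n ^ (8 * q)) (sym (m≤n⇒∣m-n∣≡n∸m qα≤2n))
                       deficit-bound

exponent-P-bound : ∀ (n p α : ℕ) → 2 ≤ n → Prime p → p % 4 ≡ 1 → IsExponent p (P n) α →
                   p ^ ∣ (p ∸ 1) * α - 2 * n ∣ ≤ n ^ (8 * (p ∸ 1))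
exponent-P-bound n zero α n≥2 pp _ _ = ⊥-elim (<⇒≱ (prime>1 pp) z≤n)
exponent-P-bound n (suc q) α n≥2 pp p%4≡1 exp-α =
  subst (λ a → suc q ^ ∣ q * a - 2 * n ∣ ≤ n ^ (8 * q))
        (sym (exponent-unique exp-α (ExponentInP.exponent-as-count pp p%4≡1 n)))
        (ExponentInPBounds.distance-bound pp p%4≡1 n≥2)

lemma3p2 :
    (∃[ C ] ∀ (n p β : ℕ) → 2 ≤ n → Prime p → p % 4 ≡ 1 →
        IsExponent p (L n) β → p ^ β ≤ n ^ C)
    ×
    (∃[ C ] ∀ (n p α : ℕ) → 2 ≤ n → Prime p → p % 4 ≡ 1 →
        IsExponent p (P n) α →
        p ^ ∣ (p ∸ 1) * α - 2 * n ∣ ≤ n ^ (C * (p ∸ 1)))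
lemma3p2 = (3 , λ n p β n≥2 pp _ → exponent-L-bound n p β n≥2 pp)
         , (8 , exponent-P-bound)
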